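{- Let $n\ge 1$ and $m\ge 1$ be integers, let $N:=(m+1)n$ and $\zeta_N:=\exp(2\pi\sqrt{ -1}/N)$. Define $$\mathcal T_n(\zeta_N;m):=\sum_{1\le i_1<i_2<\cdots<i_m\le n}\frac{1}{(1-\zeta_N^{(m+1)i_1-1})(1-\zeta_N^{(m+1)i_2-2})\cdots(1-\zeta_N^{(m+1)i_m-m})}.$$ Then $$\mathcal T_n(\zeta_{(m+1)n};m)=\frac{1}{m+1}\binom{n}{m}.$$
   Context: An empty sum is $0$; $\binom{n}{m}=0$ when $m>n$. -}

module Defs where

open import Level using (Level; _⊔_)
open import Data.Nat as ℕ using (ℕ; zero; suc; _∸_; _<_)
open import Data.List using (List; []; _∷_; map; _++_; upTo; foldr)
open import Relation.Nullary using (¬_)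
import Data.Product as P
open import Algebra.Bundles using (CommutativeRing; Semiring)
import Algebra.Definitions.RawSemiring as RS

record Field (c ℓ : Level) : Set (Level.suc (c ⊔ ℓ)) where
  field
    commutativeRing : CommutativeRing c ℓ
  open CommutativeRing commutativeRing public
  field
    _⁻¹      : Carrier → Carrier
    0≉1      : ¬ (0# ≈ 1#)
    ⁻¹-inverse : ∀ x → ¬ (x ≈ 0#) → (x * (x ⁻¹)) ≈ 1#
  open RS (Semiring.rawSemiring semiring) public using (_^_; _×_)

module _ {c ℓ} (F : Field c ℓ) where
  open Field F

  CharZero : Set ℓ
  CharZero = ∀ k → ¬ ((suc k × 1#) ≈ 0#)

  PrimitiveRoot : ℕ → Carrier → Set ℓ
  PrimitiveRoot N ζ = P.Σ (ζ ^ N ≈ 1#) (λ _ → ∀ k → 0 < k → k < N → ¬ (ζ ^ k ≈ 1#))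

choose : {A : Set} → List A → ℕ → List (List A)
choose xs       zero    = [] ∷ []
choose []       (suc m) = []
choose (x ∷ xs) (suc m) = map (x ∷_) (choose xs m) ++ choose xs (suc m)

oneTo : ℕ → List ℕ
oneTo n = map suc (upTo n)

incSeqs : ℕ → ℕ → List (List ℕ)
incSeqs n m = choose (oneTo n) m

module _ {c ℓ} (F : Field c ℓ) where
  open Field F

  termFrom : Carrier → ℕ → ℕ → List ℕ → Carrier
  termFrom ζ m j []       = 1#
  termFrom ζ m j (i ∷ is) =
    ((1# - ζ ^ (suc m ℕ.* i ∸ j)) ⁻¹) * termFrom ζ m (suc j) is

  𝒯 : ℕ → Carrier → ℕ → Carrier
  𝒯 n ζ m = foldr (λ is acc → termFrom ζ m 1 is + acc) 0# (incSeqs n m)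

{-# OPTIONS --safe #-}
-- Summing over the increasing sequences i₁ < ⋯ < iₘ is summing over the compositions
-- b = (b₁, …, bₘ₊₁) of n + 1 into positive parts, via iⱼ = b₁ + ⋯ + bⱼ. With the gaps
-- g(b) = (m + 1) b − 1 the exponents become (m + 1) iⱼ − j = g(b₁) + ⋯ + g(bⱼ) =: eⱼ, and since
-- all m + 1 gaps add up to N, the points x₀ = 1 and xⱼ = ζ^eⱼ are m + 1 distinct N-th roots of
-- unity; the summand is ∏ⱼ x₀ / (x₀ − xⱼ). Rotating b rotates these points and rescales them by
-- a root of unity, which leaves such products unchanged, so the m + 1 rotations of b contribute
-- exactly the terms ∏_{j ≠ c} x_c / (x_c − x_j) of the Lagrange interpolation identity, whose sum
-- is 1. As the sum over compositions is invariant under rotation, (m + 1) 𝒯 is the number of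
-- compositions, binom(n, m).
module Submission where

open import Defs

open import Function using (_∘_)
open import Level using (_⊔_)
open import Data.Nat as ℕ using (ℕ; zero; suc; _∸_; _≤_; _<_; _≥_; z≤n; s≤s)
import Data.Nat.Properties as ℕₚ
open import Data.Nat.Tactic.RingSolver using (solve-∀)
open import Data.Nat.ListAction using (sum)
open import Data.Nat.ListAction.Properties using (sum-++)
open import Data.Nat.Combinatorics using (_C_; nCk+nC[k+1]≡[n+1]C[k+1])
open import Data.List using (List; []; _∷_; _++_; _∷ʳ_; map; foldr; length; drop; iterate; applyUpTo)
import Data.List.Properties as List
open import Data.List.Relation.Unary.All as All using (All; []; _∷_)
import Data.List.Relation.Unary.All.Properties as All
open import Data.List.Relation.Unary.AllPairs as AllPairs using (AllPairs; []; _∷_)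
import Data.List.Relation.Unary.AllPairs.Properties as AllPairs
open import Data.List.Relation.Binary.Pointwise as Pointwise using ([]; _∷_)
open import Data.Product using (_,_; proj₁; proj₂)
open import Relation.Binary.Core using (Rel)
open import Relation.Binary.Definitions using (Symmetric)
open import Relation.Binary.PropositionalEquality as ≡ using (_≡_; cong; cong₂)
open import Relation.Unary using (Pred)
open import Algebra.Bundles using (CommutativeMonoid)

rotate : ∀ {a} {A : Set a} → List A → List A
rotate []       = []
rotate (x ∷ xs) = xs ∷ʳ x

module _ {a} {A : Set a} where
  open ≡ using (refl)

  All-rotate⁺ : ∀ {p} {P : Pred A p} {xs} → All P xs → All P (rotate xs)
  All-rotate⁺ []         = []
  All-rotate⁺ (px ∷ pxs) = All.++⁺ pxs (px ∷ [])

  AllPairs-rotate⁺ : ∀ {r} {R : Rel A r} {xs} → Symmetric R → AllPairs R xs → AllPairs R (rotate xs)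
  AllPairs-rotate⁺ sym []         = []
  AllPairs-rotate⁺ sym (Rx ∷ Rxs) = AllPairs.++⁺ Rxs ([] ∷ []) (All.map (λ r → sym r ∷ []) Rx)

  All-iterate⁺ : ∀ {p} {P : Pred A p} {f : A → A} → (∀ {x} → P x → P (f x)) →
                 ∀ {x} k → P x → All P (iterate f x k)
  All-iterate⁺ f⁺ zero    px = []
  All-iterate⁺ f⁺ (suc k) px = px ∷ All-iterate⁺ f⁺ k (f⁺ px)

  module _ {b} {B : Set b} (f : A → B) where

    rotate-map : ∀ xs → rotate (map f xs) ≡ map f (rotate xs)
    rotate-map []       = refl
    rotate-map (x ∷ xs) = ≡.sym (List.map-++ f xs (x ∷ []))

    iterate-rotate-map : ∀ xs k → iterate rotate (map f xs) k ≡ map (map f) (iterate rotate xs k)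
    iterate-rotate-map xs zero    = refl
    iterate-rotate-map xs (suc k) = cong (map f xs ∷_)
      (≡.trans (cong (λ ys → iterate rotate ys k) (rotate-map xs)) (iterate-rotate-map (rotate xs) k))

module _ where
  open ≡ using (refl)
  open import Data.Nat using (_+_; _*_)
  open ℕₚ using ( +-identityʳ; +-assoc; +-comm; +-suc; *-zeroʳ; *-distribˡ-+; ∸-+-assoc
                ; m∸n+n≡m; m<n⇒0<n∸m; ≤-refl; ≤-trans; <-≤-trans; m≤m+n; m<m+n; *-mono-≤ )

  length-choose : ∀ {A : Set} (xs : List A) k → length (choose xs k) ≡ length xs C k
  length-choose xs       zero    = refl
  length-choose []       (suc k) = refl
  length-choose (x ∷ xs) (suc k) = begin
    length (map (x ∷_) (choose xs k) ++ choose xs (suc k))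
      ≡⟨ List.length-++ (map (x ∷_) (choose xs k)) ⟩
    length (map (x ∷_) (choose xs k)) + length (choose xs (suc k))
      ≡⟨ cong (_+ _) (List.length-map (x ∷_) (choose xs k)) ⟩
    length (choose xs k) + length (choose xs (suc k))
      ≡⟨ cong₂ _+_ (length-choose xs k) (length-choose xs (suc k)) ⟩
    length xs C k + length xs C suc k
      ≡⟨ nCk+nC[k+1]≡[n+1]C[k+1] (length xs) k ⟩
    suc (length xs) C suc k ∎
    where open ≡.≡-Reasoning

  applyUpTo≡iterate : ∀ {f : ℕ → ℕ} b n → (∀ i → f i ≡ b + i) → applyUpTo f n ≡ iterate suc b n
  applyUpTo≡iterate b zero    f≗b+ = refl
  applyUpTo≡iterate b (suc n) f≗b+ = cong₂ _∷_ (≡.trans (f≗b+ 0) (+-identityʳ b))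
    (applyUpTo≡iterate (suc b) n (λ i → ≡.trans (f≗b+ (suc i)) (+-suc b i)))

  oneTo≡iterate : ∀ n → oneTo n ≡ iterate suc 1 n
  oneTo≡iterate n = ≡.trans (List.map-upTo suc n) (applyUpTo≡iterate 1 n (λ _ → refl))

  sum-rotate : ∀ ds → sum (rotate ds) ≡ sum ds
  sum-rotate []       = refl
  sum-rotate (d ∷ ds) = ≡.trans (sum-++ ds (d ∷ [])) (≡.trans (cong (sum ds +_) (+-identityʳ d)) (+-comm (sum ds) d))

  ∸-comm : ∀ s a b → s ∸ a ∸ b ≡ s ∸ b ∸ a
  ∸-comm s a b = ≡.trans (∸-+-assoc s a b) (≡.trans (cong (s ∸_) (+-comm a b)) (≡.sym (∸-+-assoc s b a)))

  partialSums : ℕ → List ℕ → List ℕ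
  partialSums s []       = []
  partialSums s (d ∷ ds) = s ∷ partialSums (s + d) ds

  length-partialSums : ∀ s ds → length (partialSums s ds) ≡ length ds
  length-partialSums s []       = refl
  length-partialSums s (d ∷ ds) = cong suc (length-partialSums (s + d) ds)

  map-+-partialSums : ∀ a s ds → map (a +_) (partialSums s ds) ≡ partialSums (a + s) ds
  map-+-partialSums a s []       = refl
  map-+-partialSums a s (d ∷ ds) = cong (a + s ∷_)
    (≡.trans (map-+-partialSums a (s + d) ds) (cong (λ t → partialSums t ds) (≡.sym (+-assoc a s d))))

  partialSums-∷ʳ : ∀ s ds d → partialSums s (ds ∷ʳ d) ≡ partialSums s ds ∷ʳ (s + sum ds)
  partialSums-∷ʳ s []        d = cong (_∷ []) (≡.sym (+-identityʳ s))
  partialSums-∷ʳ s (d′ ∷ ds) d = cong (s ∷_)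
    (≡.trans (partialSums-∷ʳ (s + d′) ds d) (cong (λ t → partialSums (s + d′) ds ∷ʳ t) (+-assoc s d′ (sum ds))))

  partialSums-rotate : ∀ d ds → map (d +_) (partialSums 0 (rotate (d ∷ ds))) ≡ partialSums d ds ∷ʳ sum (d ∷ ds)
  partialSums-rotate d ds = begin
    map (d +_) (partialSums 0 (ds ∷ʳ d))              ≡⟨ cong (map (d +_)) (partialSums-∷ʳ 0 ds d) ⟩
    map (d +_) (partialSums 0 ds ∷ʳ sum ds)           ≡⟨ List.map-++ (d +_) (partialSums 0 ds) _ ⟩
    map (d +_) (partialSums 0 ds) ∷ʳ sum (d ∷ ds)     ≡⟨ cong (_∷ʳ sum (d ∷ ds)) (map-+-partialSums d 0 ds) ⟩
    partialSums (d + 0) ds ∷ʳ sum (d ∷ ds)            ≡⟨ cong (λ t → partialSums t ds ∷ʳ sum (d ∷ ds)) (+-identityʳ d) ⟩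
    partialSums d ds ∷ʳ sum (d ∷ ds)                  ∎
    where open ≡.≡-Reasoning

  partialSums-lowerBound : ∀ s ds → All (s ≤_) (partialSums s ds)
  partialSums-lowerBound s []       = []
  partialSums-lowerBound s (d ∷ ds) =
    ≤-refl ∷ All.map (≤-trans (m≤m+n s d)) (partialSums-lowerBound (s + d) ds)

  partialSums-upperBound : ∀ s {ds} → All (0 <_) ds → All (_< s + sum ds) (partialSums s ds)
  partialSums-upperBound s {[]}     []           = []
  partialSums-upperBound s {d ∷ ds} (d>0 ∷ ds>0) =
    m<m+n s (≤-trans d>0 (m≤m+n d (sum ds))) ∷
    ≡.subst (λ t → All (_< t) (partialSums (s + d) ds)) (+-assoc s d (sum ds)) (partialSums-upperBound (s + d) ds>0)

  partialSums-increasing : ∀ s {ds} → All (0 <_) ds → AllPairs _<_ (partialSums s ds)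
  partialSums-increasing s {[]}     []           = []
  partialSums-increasing s {d ∷ ds} (d>0 ∷ ds>0) =
    All.map (<-≤-trans (m<m+n s d>0)) (partialSums-lowerBound (s + d) ds) ∷ partialSums-increasing (s + d) ds>0

  gap : ℕ → ℕ → ℕ
  gap m b = suc m * b ∸ 1

  gap+1≡ : ∀ m {b} → 0 < b → gap m b + 1 ≡ suc m * b
  gap+1≡ m {b} b>0 = m∸n+n≡m (≤-trans b>0 (m≤m+n b (m * b)))

  gap>0 : ∀ {m b} → 0 < m → 0 < b → 0 < gap m b
  gap>0 m>0 b>0 = m<n⇒0<n∸m (*-mono-≤ (s≤s m>0) b>0)

  gap-step : ∀ m {e j i b} → e + j ≡ suc m * i → 0 < b → (e + gap m b) + suc j ≡ suc m * (i + b)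
  gap-step m {e} {j} {i} {b} e+j≡ b>0 = begin
    (e + gap m b) + suc j        ≡⟨ swap-middle e (gap m b) j ⟩
    (e + j) + (gap m b + 1)      ≡⟨ cong₂ _+_ e+j≡ (gap+1≡ m b>0) ⟩
    suc m * i + suc m * b        ≡⟨ *-distribˡ-+ (suc m) i b ⟨
    suc m * (i + b)              ∎
    where
    open ≡.≡-Reasoning
    swap-middle : ∀ x y z → (x + y) + suc z ≡ (x + z) + (y + 1)
    swap-middle = solve-∀

  sum-map-gap : ∀ m {bs} → All (0 <_) bs → sum (map (gap m) bs) + length bs ≡ suc m * sum bs
  sum-map-gap m {[]}     []           = ≡.sym (*-zeroʳ (suc m))
  sum-map-gap m {b ∷ bs} (b>0 ∷ bs>0) = begin
    (gap m b + sum (map (gap m) bs)) + suc (length bs)   ≡⟨ swap-middle (gap m b) _ (length bs) ⟩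
    (gap m b + 1) + (sum (map (gap m) bs) + length bs)   ≡⟨ cong₂ _+_ (gap+1≡ m b>0) (sum-map-gap m bs>0) ⟩
    suc m * b + suc m * sum bs                           ≡⟨ *-distribˡ-+ (suc m) b (sum bs) ⟨
    suc m * (b + sum bs)                                 ∎
    where
    open ≡.≡-Reasoning
    swap-middle : ∀ x y z → (x + y) + suc z ≡ (x + 1) + (y + z)
    swap-middle = solve-∀

record IsComposition (r s : ℕ) (bs : List ℕ) : Set where
  field
    length≡ : length bs ≡ r
    sum≡    : sum bs ≡ s
    parts>0 : All (0 <_) bs

∷-isComposition : ∀ {r s a bs} → a < s → IsComposition r (s ∸ suc a) bs → IsComposition (suc r) s (suc a ∷ bs)
∷-isComposition a<s c = record
  { length≡ = cong suc (IsComposition.length≡ c)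
  ; sum≡    = ≡.trans (cong (suc _ ℕ.+_) (IsComposition.sum≡ c)) (ℕₚ.m+[n∸m]≡n a<s)
  ; parts>0 = s≤s z≤n ∷ IsComposition.parts>0 c
  }

sum-map-gap-composition : ∀ m n {bs} → IsComposition (suc m) (suc n) bs → sum (map (gap m) bs) ≡ suc m ℕ.* n
sum-map-gap-composition m n {bs} c = ℕₚ.+-cancelʳ-≡ (suc m) _ _ (begin
  sum (map (gap m) bs) ℕ.+ suc m       ≡⟨ cong (sum (map (gap m) bs) ℕ.+_) (≡.sym (IsComposition.length≡ c)) ⟩
  sum (map (gap m) bs) ℕ.+ length bs   ≡⟨ sum-map-gap m (IsComposition.parts>0 c) ⟩
  suc m ℕ.* sum bs                     ≡⟨ cong (suc m ℕ.*_) (IsComposition.sum≡ c) ⟩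
  suc m ℕ.* suc n                      ≡⟨ ℕₚ.*-suc (suc m) n ⟩
  suc m ℕ.+ suc m ℕ.* n                ≡⟨ ℕₚ.+-comm (suc m) _ ⟩
  suc m ℕ.* n ℕ.+ suc m                ∎)
  where open ≡.≡-Reasoning

module BigOperators {c ℓ} (M : CommutativeMonoid c ℓ) where

  open CommutativeMonoid M renaming (Carrier to A)
  open ℕₚ using (+-comm; +-suc; n∸n≡0)
  open import Algebra.Definitions.RawMonoid rawMonoid using (_×_)
  open import Algebra.Properties.CommutativeSemigroup commutativeSemigroup using (interchange; x∙yz≈y∙xz)
  open import Relation.Binary.Reasoning.Setoid setoid

  ∑ : ∀ {x} {X : Set x} → List X → (X → A) → A
  ∑ xs f = foldr (λ x acc → f x ∙ acc) ε xs

  module _ {x} {X : Set x} where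

    ∑-cong : ∀ {xs : List X} {f g : X → A} → All (λ x → f x ≈ g x) xs → ∑ xs f ≈ ∑ xs g
    ∑-cong []           = refl
    ∑-cong (fx≈gx ∷ eq) = ∙-cong fx≈gx (∑-cong eq)

    ∑-++ : ∀ (xs ys : List X) f → ∑ (xs ++ ys) f ≈ ∑ xs f ∙ ∑ ys f
    ∑-++ []       ys f = sym (identityˡ _)
    ∑-++ (x ∷ xs) ys f = trans (∙-congˡ (∑-++ xs ys f)) (sym (assoc _ _ _))

    ∑-∷ʳ : ∀ (xs : List X) x f → ∑ (xs ∷ʳ x) f ≈ f x ∙ ∑ xs f
    ∑-∷ʳ []       x f = refl
    ∑-∷ʳ (y ∷ xs) x f = trans (∙-congˡ (∑-∷ʳ xs x f)) (x∙yz≈y∙xz _ _ _)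

    ∑-const : ∀ (xs : List X) a → ∑ xs (λ _ → a) ≈ length xs × a
    ∑-const []       a = refl
    ∑-const (_ ∷ xs) a = ∙-congˡ (∑-const xs a)

    ∑-map : ∀ {y} {Y : Set y} (h : Y → X) ys f → ∑ (map h ys) f ≡ ∑ ys (f ∘ h)
    ∑-map h ys f = List.foldr-map _ h ε ys

  ∑< : ℕ → (ℕ → A) → A
  ∑< zero    f = ε
  ∑< (suc n) f = f 0 ∙ ∑< n (f ∘ suc)

  ∑<-cong : ∀ n {f g} → (∀ i → i < n → f i ≈ g i) → ∑< n f ≈ ∑< n g
  ∑<-cong zero    eq = refl
  ∑<-cong (suc n) eq = ∙-cong (eq 0 (s≤s z≤n)) (∑<-cong n (λ i i<n → eq (suc i) (s≤s i<n)))

  ∑<-∙ : ∀ n f g → ∑< n (λ i → f i ∙ g i) ≈ ∑< n f ∙ ∑< n g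
  ∑<-∙ zero    f g = sym (identityˡ ε)
  ∑<-∙ (suc n) f g = trans (∙-congˡ (∑<-∙ n _ _)) (interchange _ _ _ _)

  ∑<-ε : ∀ n → ∑< n (λ _ → ε) ≈ ε
  ∑<-ε zero    = refl
  ∑<-ε (suc n) = trans (identityˡ _) (∑<-ε n)

  ∑<-snoc : ∀ n f → ∑< (suc n) f ≈ ∑< n f ∙ f n
  ∑<-snoc zero    f = comm (f 0) ε
  ∑<-snoc (suc n) f = trans (∙-congˡ (∑<-snoc n (f ∘ suc))) (sym (assoc _ _ _))

  ∑<-∸ : ∀ {s b} → b < s → ∀ g → ∑< (s ∸ b) g ≈ g 0 ∙ ∑< (s ∸ suc b) (g ∘ suc)
  ∑<-∸ {suc s} {zero}  _         g = refl
  ∑<-∸ {suc s} {suc b} (s≤s b<s) g = ∑<-∸ b<s g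

  ∑<-triangle : ∀ s (H : ℕ → ℕ → A) →
                ∑< s (λ a → ∑< (s ∸ suc a) (H a)) ≈ ∑< s (λ b → ∑< (s ∸ suc b) (λ a → H a b))
  ∑<-triangle zero    H = refl
  ∑<-triangle (suc s) H = begin
    ∑< s (H 0) ∙ ∑< s (λ a → ∑< (s ∸ suc a) (H (suc a)))
      ≈⟨ ∙-congˡ (∑<-triangle s (H ∘ suc)) ⟩
    ∑< s (H 0) ∙ ∑< s (λ b → ∑< (s ∸ suc b) (λ a → H (suc a) b))
      ≈⟨ ∑<-∙ s _ _ ⟨
    ∑< s (λ b → H 0 b ∙ ∑< (s ∸ suc b) (λ a → H (suc a) b))
      ≈⟨ ∑<-cong s (λ b b<s → sym (∑<-∸ b<s (λ a → H a b))) ⟩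
    ∑< s (λ b → ∑< (s ∸ b) (λ a → H a b))
      ≈⟨ identityʳ _ ⟨
    ∑< s (λ b → ∑< (s ∸ b) (λ a → H a b)) ∙ ε
      ≡⟨ cong (λ t → ∑< s (λ b → ∑< (s ∸ b) (λ a → H a b)) ∙ ∑< t (λ a → H a s)) (≡.sym (n∸n≡0 s)) ⟩
    ∑< s (λ b → ∑< (s ∸ b) (λ a → H a b)) ∙ ∑< (s ∸ s) (λ a → H a s)
      ≈⟨ ∑<-snoc s _ ⟨
    ∑< (suc s) (λ b → ∑< (suc s ∸ suc b) (λ a → H a b)) ∎

  ∑comp : ℕ → ℕ → (List ℕ → A) → A
  ∑comp zero    zero    f = f []
  ∑comp zero    (suc s) f = ε
  ∑comp (suc r) s       f = ∑< s (λ a → ∑comp r (s ∸ suc a) (λ bs → f (suc a ∷ bs)))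

  ∑comp-cong : ∀ r s {f g} → (∀ bs → IsComposition r s bs → f bs ≈ g bs) → ∑comp r s f ≈ ∑comp r s g
  ∑comp-cong zero    zero    eq = eq [] (record { length≡ = ≡.refl ; sum≡ = ≡.refl ; parts>0 = [] })
  ∑comp-cong zero    (suc s) eq = refl
  ∑comp-cong (suc r) s       eq = ∑<-cong s (λ a a<s →
    ∑comp-cong r (s ∸ suc a) (λ bs c → eq (suc a ∷ bs) (∷-isComposition a<s c)))

  ∑comp-∙ : ∀ r s f g → ∑comp r s (λ bs → f bs ∙ g bs) ≈ ∑comp r s f ∙ ∑comp r s g
  ∑comp-∙ zero    zero    f g = refl
  ∑comp-∙ zero    (suc s) f g = sym (identityˡ ε)
  ∑comp-∙ (suc r) s       f g = trans (∑<-cong s (λ a _ → ∑comp-∙ r (s ∸ suc a) _ _)) (∑<-∙ s _ _)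

  ∑comp-ε : ∀ r s → ∑comp r s (λ _ → ε) ≈ ε
  ∑comp-ε zero    zero    = refl
  ∑comp-ε zero    (suc s) = refl
  ∑comp-ε (suc r) s       = trans (∑<-cong s (λ a _ → ∑comp-ε r (s ∸ suc a))) (∑<-ε s)

  ∑comp-zero-cong : ∀ s {f g} → f [] ≈ g [] → ∑comp 0 s f ≈ ∑comp 0 s g
  ∑comp-zero-cong zero    f[]≈g[] = f[]≈g[]
  ∑comp-zero-cong (suc s) f[]≈g[] = refl

  ∑comp-single : ∀ l f → ∑comp 1 (suc l) f ≈ f (suc l ∷ [])
  ∑comp-single l f = go l (λ a bs → f (suc a ∷ bs))
    where
    go : ∀ l (h : ℕ → List ℕ → A) → ∑< (suc l) (λ a → ∑comp 0 (l ∸ a) (h a)) ≈ h l []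
    go zero    h = identityʳ _
    go (suc l) h = trans (identityˡ _) (go l (h ∘ suc))

  ∑comp-last : ∀ r s f → ∑comp (suc r) s f ≈ ∑< s (λ a → ∑comp r (s ∸ suc a) (λ bs → f (bs ∷ʳ suc a)))
  ∑comp-last zero    s f = ∑<-cong s (λ a _ → ∑comp-zero-cong (s ∸ suc a) refl)
  ∑comp-last (suc r) s f = begin
    ∑< s (λ a → ∑comp (suc r) (s ∸ suc a) (λ bs → f (suc a ∷ bs)))
      ≈⟨ ∑<-cong s (λ a _ → ∑comp-last r (s ∸ suc a) (λ bs → f (suc a ∷ bs))) ⟩
    ∑< s (λ a → ∑< (s ∸ suc a) (λ b → ∑comp r (s ∸ suc a ∸ suc b) (λ bs → f (suc a ∷ bs ∷ʳ suc b))))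
      ≈⟨ ∑<-triangle s _ ⟩
    ∑< s (λ b → ∑< (s ∸ suc b) (λ a → ∑comp r (s ∸ suc a ∸ suc b) (λ bs → f (suc a ∷ bs ∷ʳ suc b))))
      ≈⟨ ∑<-cong s (λ b _ → ∑<-cong (s ∸ suc b) (λ a _ →
           reflexive (cong (λ t → ∑comp r t (λ bs → f (suc a ∷ bs ∷ʳ suc b))) (∸-comm s (suc a) (suc b))))) ⟩
    ∑< s (λ b → ∑comp (suc r) (s ∸ suc b) (λ bs → f (bs ∷ʳ suc b))) ∎

  ∑comp-rotate : ∀ r s f → ∑comp (suc r) s (f ∘ rotate) ≈ ∑comp (suc r) s f
  ∑comp-rotate r s f = sym (∑comp-last r s f)

  ∑comp-∑-rotations : ∀ k r s f → ∑comp (suc r) s (λ bs → ∑ (iterate rotate bs k) f) ≈ k × ∑comp (suc r) s f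
  ∑comp-∑-rotations zero    r s f = ∑comp-ε (suc r) s
  ∑comp-∑-rotations (suc k) r s f = begin
    ∑comp (suc r) s (λ bs → f bs ∙ ∑ (iterate rotate (rotate bs) k) f)
      ≈⟨ ∑comp-∙ (suc r) s f (λ bs → ∑ (iterate rotate (rotate bs) k) f) ⟩
    ∑comp (suc r) s f ∙ ∑comp (suc r) s (λ bs → ∑ (iterate rotate (rotate bs) k) f)
      ≈⟨ ∙-congˡ (∑comp-rotate r s (λ bs → ∑ (iterate rotate bs k) f)) ⟩
    ∑comp (suc r) s f ∙ ∑comp (suc r) s (λ bs → ∑ (iterate rotate bs k) f)
      ≈⟨ ∙-congˡ (∑comp-∑-rotations k r s f) ⟩
    ∑comp (suc r) s f ∙ k × ∑comp (suc r) s f ∎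

  ∑-choose : ∀ off l k (f : List ℕ → A) →
             ∑ (choose (iterate suc (suc off) l) k) f ≈ ∑comp (suc k) (suc l) (f ∘ drop 1 ∘ partialSums off)
  ∑-choose off l       zero    f = trans (identityʳ (f [])) (sym (∑comp-single l (f ∘ drop 1 ∘ partialSums off)))
  ∑-choose off zero    (suc k) f = sym (identityˡ ε)
  ∑-choose off (suc l) (suc k) f = begin
    ∑ (map (suc off ∷_) C₁ ++ C₂) f
      ≈⟨ ∑-++ (map (suc off ∷_) C₁) C₂ f ⟩
    ∑ (map (suc off ∷_) C₁) f ∙ ∑ C₂ f
      ≡⟨ cong (_∙ ∑ C₂ f) (∑-map (suc off ∷_) C₁ f) ⟩
    ∑ C₁ (f ∘ (suc off ∷_)) ∙ ∑ C₂ f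
      ≈⟨ ∙-cong (∑-choose (suc off) l k _) (∑-choose (suc off) l (suc k) f) ⟩
    ∑comp (suc k) (suc l) (λ bs → f (suc off ∷ drop 1 (partialSums (suc off) bs))) ∙
    ∑comp (suc (suc k)) (suc l) (f ∘ drop 1 ∘ partialSums (suc off))
      ≈⟨ ∙-cong (∑comp-cong (suc k) (suc l) first)
                (∑<-cong (suc l) (λ a _ → ∑comp-cong (suc k) (l ∸ a) (λ bs _ → later a bs))) ⟩
    ∑comp (suc (suc k)) (suc (suc l)) (f ∘ drop 1 ∘ partialSums off) ∎
    where
    C₁ = choose (iterate suc (suc (suc off)) l) k
    C₂ = choose (iterate suc (suc (suc off)) l) (suc k)
    first : ∀ bs → IsComposition (suc k) (suc l) bs →
            f (suc off ∷ drop 1 (partialSums (suc off) bs)) ≈ f (partialSums (off ℕ.+ 1) bs)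
    first (b ∷ bs) _ = reflexive (cong (λ t → f (partialSums t (b ∷ bs))) (≡.sym (+-comm off 1)))
    later : ∀ a bs → f (partialSums (suc off ℕ.+ suc a) bs) ≈ f (partialSums (off ℕ.+ suc (suc a)) bs)
    later a bs = reflexive (cong (λ t → f (partialSums t bs)) (≡.sym (+-suc off (suc a))))

  ∑comp-const : ∀ m n a → ∑comp (suc m) (suc n) (λ _ → a) ≈ (n C m) × a
  ∑comp-const m n a = begin
    ∑comp (suc m) (suc n) (λ _ → a)             ≈⟨ ∑-choose 0 n m (λ _ → a) ⟨
    ∑ (choose (iterate suc 1 n) m) (λ _ → a)    ≈⟨ ∑-const (choose (iterate suc 1 n) m) a ⟩
    length (choose (iterate suc 1 n) m) × a     ≡⟨ cong (_× a) (length-choose (iterate suc 1 n) m) ⟩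
    (length (iterate suc 1 n) C m) × a          ≡⟨ cong (λ l → (l C m) × a) (List.length-iterate suc 1 n) ⟩
    (n C m) × a                                 ∎

module FieldTheory {c ℓ} (F : Field c ℓ) where

  open Field F
  open import Algebra.Properties.Ring ring using (x[y-z]≈xy-xz; -‿distribʳ-*)
  open import Algebra.Properties.AbelianGroup +-abelianGroup using (⁻¹-anti-homo‿-)
  open import Algebra.Properties.CommutativeSemigroup +-commutativeSemigroup
    using (xy∙z≈xz∙y) renaming (interchange to +-interchange)
  open import Algebra.Properties.CommutativeSemigroup *-commutativeSemigroup
    using (x∙yz≈y∙xz) renaming (interchange to *-interchange)
  open import Algebra.Properties.Semiring.Exp semiring using (^-homo-*)
  open import Data.List.Relation.Unary.Unique.Setoid setoid using (Unique)
  open import Data.List.Relation.Binary.Equality.Setoid setoid using (_≋_; ≋-refl; ≋-reflexive; ≋-trans)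
  open import Relation.Binary.Reasoning.Setoid setoid
  open BigOperators +-commutativeMonoid using (∑)
  open BigOperators *-commutativeMonoid using () renaming (∑ to ∏; ∑-∷ʳ to ∏-∷ʳ)

  x*y≈1⇒x≉0 : ∀ {x y} → x * y ≈ 1# → x ≉ 0#
  x*y≈1⇒x≉0 {x} {y} xy≈1 x≈0 = 0≉1 (begin
    0#     ≈⟨ zeroˡ y ⟨
    0# * y ≈⟨ *-congʳ x≈0 ⟨
    x * y  ≈⟨ xy≈1 ⟩
    1#     ∎)

  ⁻¹-inverseˡ : ∀ {x} → x ≉ 0# → x ⁻¹ * x ≈ 1#
  ⁻¹-inverseˡ {x} x≉0 = trans (*-comm (x ⁻¹) x) (⁻¹-inverse x x≉0)

  *-cancelʳ : ∀ {x y z} → z ≉ 0# → x * z ≈ y * z → x ≈ y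
  *-cancelʳ {x} {y} {z} z≉0 xz≈yz = begin
    x              ≈⟨ *-identityʳ x ⟨
    x * 1#         ≈⟨ *-congˡ (⁻¹-inverse z z≉0) ⟨
    x * (z * z ⁻¹) ≈⟨ *-assoc x z (z ⁻¹) ⟨
    x * z * z ⁻¹   ≈⟨ *-congʳ xz≈yz ⟩
    y * z * z ⁻¹   ≈⟨ *-assoc y z (z ⁻¹) ⟩
    y * (z * z ⁻¹) ≈⟨ *-congˡ (⁻¹-inverse z z≉0) ⟩
    y * 1#         ≈⟨ *-identityʳ y ⟩
    y              ∎

  *-≉0 : ∀ {x y} → x ≉ 0# → y ≉ 0# → x * y ≉ 0#
  *-≉0 {x} {y} x≉0 y≉0 xy≈0 = y≉0 (*-cancelʳ x≉0 (trans (*-comm y x) (trans xy≈0 (sym (zeroˡ x)))))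

  x-y+y≈x : ∀ x y → x - y + y ≈ x
  x-y+y≈x x y = begin
    x - y + y     ≈⟨ +-assoc x (- y) y ⟩
    x + (- y + y) ≈⟨ +-congˡ (-‿inverseˡ y) ⟩
    x + 0#        ≈⟨ +-identityʳ x ⟩
    x             ∎

  x-y+[y-z]≈x-z : ∀ x y z → (x - y) + (y - z) ≈ x - z
  x-y+[y-z]≈x-z x y z = begin
    (x - y) + (y - z)   ≈⟨ +-assoc x (- y) (y - z) ⟩
    x + (- y + (y - z)) ≈⟨ +-congˡ (+-assoc (- y) y (- z)) ⟨
    x + (- y + y - z)   ≈⟨ +-congˡ (+-congʳ (-‿inverseˡ y)) ⟩
    x + (0# - z)        ≈⟨ +-congˡ (+-identityˡ (- z)) ⟩
    x - z               ∎

  x≉y⇒x-y≉0 : ∀ {x y} → x ≉ y → x - y ≉ 0#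
  x≉y⇒x-y≉0 {x} {y} x≉y x-y≈0 = x≉y (begin
    x         ≈⟨ x-y+y≈x x y ⟨
    x - y + y ≈⟨ +-congʳ x-y≈0 ⟩
    0# + y    ≈⟨ +-identityˡ y ⟩
    y         ∎)

  x*y≈z⇒y≈x⁻¹*z : ∀ {x y z} → x ≉ 0# → x * y ≈ z → y ≈ x ⁻¹ * z
  x*y≈z⇒y≈x⁻¹*z {x} {y} {z} x≉0 xy≈z = begin
    y              ≈⟨ *-identityˡ y ⟨
    1# * y         ≈⟨ *-congʳ (⁻¹-inverseˡ x≉0) ⟨
    x ⁻¹ * x * y   ≈⟨ *-assoc (x ⁻¹) x y ⟩
    x ⁻¹ * (x * y) ≈⟨ *-congˡ xy≈z ⟩
    x ⁻¹ * z       ∎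

  infix 8 _⊘_
  _⊘_ : Carrier → Carrier → Carrier
  x ⊘ z = x * (x - z) ⁻¹

  ⊘-*-sub : ∀ {x z} → x ≉ z → x ⊘ z * (x - z) ≈ x
  ⊘-*-sub {x} {z} x≉z = begin
    x * (x - z) ⁻¹ * (x - z)   ≈⟨ *-assoc x _ _ ⟩
    x * ((x - z) ⁻¹ * (x - z)) ≈⟨ *-congˡ (⁻¹-inverseˡ (x≉y⇒x-y≉0 x≉z)) ⟩
    x * 1#                     ≈⟨ *-identityʳ x ⟩
    x                          ∎

  ⊘-*-flip : ∀ {x z} → x ≉ z → z ⊘ x * (x - z) ≈ - z
  ⊘-*-flip {x} {z} x≉z = begin
    z ⊘ x * (x - z)     ≈⟨ *-congˡ (⁻¹-anti-homo‿- z x) ⟨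
    z ⊘ x * - (z - x)   ≈⟨ -‿distribʳ-* (z ⊘ x) (z - x) ⟨
    - (z ⊘ x * (z - x)) ≈⟨ -‿cong (⊘-*-sub (x≉z ∘ sym)) ⟩
    - z                 ∎

  ⊘-unique : ∀ {x z t} → x ≉ z → t * (x - z) ≈ x → t ≈ x ⊘ z
  ⊘-unique x≉z t[x-z]≈x = *-cancelʳ (x≉y⇒x-y≉0 x≉z) (trans t[x-z]≈x (sym (⊘-*-sub x≉z)))

  ⊘-scale : ∀ {μ x z y w} → μ ≉ 0# → μ * x ≈ y → μ * z ≈ w → y ≉ w → x ⊘ z ≈ y ⊘ w
  ⊘-scale {μ} {x} {z} {y} {w} μ≉0 μx≈y μz≈w y≉w = ⊘-unique y≉w (begin
    x ⊘ z * (y - w)         ≈⟨ *-congˡ (+-cong μx≈y (-‿cong μz≈w)) ⟨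
    x ⊘ z * (μ * x - μ * z) ≈⟨ *-congˡ (x[y-z]≈xy-xz μ x z) ⟨
    x ⊘ z * (μ * (x - z))   ≈⟨ x∙yz≈y∙xz (x ⊘ z) μ (x - z) ⟩
    μ * (x ⊘ z * (x - z))   ≈⟨ *-congˡ (⊘-*-sub x≉z) ⟩
    μ * x                   ≈⟨ μx≈y ⟩
    y                       ∎)
    where
    x≉z : x ≉ z
    x≉z x≈z = y≉w (trans (sym μx≈y) (trans (*-congˡ x≈z) μz≈w))

  ⊘-complement : ∀ {x z} → x ≉ z → x ⊘ z + z ⊘ x ≈ 1#
  ⊘-complement {x} {z} x≉z = *-cancelʳ (x≉y⇒x-y≉0 x≉z) (begin
    (x ⊘ z + z ⊘ x) * (x - z)         ≈⟨ distribʳ (x - z) (x ⊘ z) (z ⊘ x) ⟩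
    x ⊘ z * (x - z) + z ⊘ x * (x - z) ≈⟨ +-cong (⊘-*-sub x≉z) (⊘-*-flip x≉z) ⟩
    x - z                             ≈⟨ *-identityˡ (x - z) ⟨
    1# * (x - z)                      ∎)

  -- Lagrange interpolation of the identity function at the nodes x and b.
  ⊘-interpolate : ∀ {x b} y → x ≉ b → x ⊘ b * (y - b) + b ⊘ x * (y - x) ≈ y
  ⊘-interpolate {x} {b} y x≉b = begin
    x ⊘ b * (y - b) + b ⊘ x * (y - x)
      ≈⟨ +-congʳ (*-congˡ (x-y+[y-z]≈x-z y x b)) ⟨
    x ⊘ b * ((y - x) + (x - b)) + b ⊘ x * (y - x)
      ≈⟨ +-congʳ (trans (distribˡ (x ⊘ b) (y - x) (x - b)) (+-congˡ (⊘-*-sub x≉b))) ⟩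
    x ⊘ b * (y - x) + x + b ⊘ x * (y - x)
      ≈⟨ xy∙z≈xz∙y _ x _ ⟩
    x ⊘ b * (y - x) + b ⊘ x * (y - x) + x
      ≈⟨ +-congʳ (distribʳ (y - x) (x ⊘ b) (b ⊘ x)) ⟨
    (x ⊘ b + b ⊘ x) * (y - x) + x
      ≈⟨ +-congʳ (trans (*-congʳ (⊘-complement x≉b)) (*-identityˡ (y - x))) ⟩
    y - x + x
      ≈⟨ x-y+y≈x y x ⟩
    y ∎

  -- Multiplied by (y − b) (y − x), both sides become y², the right one by ⊘-interpolate.
  ⊘-partialFraction : ∀ {y x b} → y ≉ x → y ≉ b → x ≉ b →
                      y ⊘ b * y ⊘ x ≈ y ⊘ x * x ⊘ b + y ⊘ b * b ⊘ x
  ⊘-partialFraction {y} {x} {b} y≉x y≉b x≉b = *-cancelʳ (*-≉0 (x≉y⇒x-y≉0 y≉b) (x≉y⇒x-y≉0 y≉x)) (begin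
    y ⊘ b * y ⊘ x * ((y - b) * (y - x))
      ≈⟨ *-interchange (y ⊘ b) (y ⊘ x) (y - b) (y - x) ⟩
    y ⊘ b * (y - b) * (y ⊘ x * (y - x))
      ≈⟨ *-cong (⊘-*-sub y≉b) (⊘-*-sub y≉x) ⟩
    y * y
      ≈⟨ *-congˡ (⊘-interpolate y x≉b) ⟨
    y * (x ⊘ b * (y - b) + b ⊘ x * (y - x))
      ≈⟨ distribˡ y _ _ ⟩
    y * (x ⊘ b * (y - b)) + y * (b ⊘ x * (y - x))
      ≈⟨ +-cong (*-congʳ (⊘-*-sub y≉x)) (*-congʳ (⊘-*-sub y≉b)) ⟨
    y ⊘ x * (y - x) * (x ⊘ b * (y - b)) + y ⊘ b * (y - b) * (b ⊘ x * (y - x))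
      ≈⟨ +-cong (trans (*-congˡ (*-comm (y - b) (y - x))) (*-interchange _ _ _ _)) (*-interchange _ _ _ _) ⟨
    y ⊘ x * x ⊘ b * ((y - b) * (y - x)) + y ⊘ b * b ⊘ x * ((y - b) * (y - x))
      ≈⟨ distribʳ ((y - b) * (y - x)) _ _ ⟨
    (y ⊘ x * x ⊘ b + y ⊘ b * b ⊘ x) * ((y - b) * (y - x)) ∎)

  -- ∑pick g xs sums g x (xs with x removed) over the members x of xs.
  ∑pick : (Carrier → List Carrier → Carrier) → List Carrier → Carrier
  ∑pick g []       = 0#
  ∑pick g (z ∷ zs) = g z zs + ∑pick (λ x rest → g x (z ∷ rest)) zs

  ∑pick-cong : ∀ {g h} zs → All (λ x → ∀ rest → g x rest ≈ h x rest) zs → ∑pick g zs ≈ ∑pick h zs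
  ∑pick-cong []       []          = refl
  ∑pick-cong (z ∷ zs) (gz≈hz ∷ eq) = +-cong (gz≈hz zs) (∑pick-cong zs (All.map (λ gx≈hx rest → gx≈hx (z ∷ rest)) eq))

  ∑pick-+ : ∀ g h zs → ∑pick (λ x rest → g x rest + h x rest) zs ≈ ∑pick g zs + ∑pick h zs
  ∑pick-+ g h []       = sym (+-identityˡ 0#)
  ∑pick-+ g h (z ∷ zs) = trans (+-congˡ (∑pick-+ _ _ zs)) (+-interchange _ _ _ _)

  ∑pick-* : ∀ k g zs → ∑pick (λ x rest → k * g x rest) zs ≈ k * ∑pick g zs
  ∑pick-* k g []       = sym (zeroʳ k)
  ∑pick-* k g (z ∷ zs) = trans (+-congˡ (∑pick-* k _ zs)) (sym (distribˡ k _ _))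

  ∏⊘-partialFractions : ∀ {y} b zs → All (y ≉_) (b ∷ zs) → Unique (b ∷ zs) →
    ∏ (b ∷ zs) (y ⊘_) ≈ ∑pick (λ x rest → y ⊘ x * ∏ rest (x ⊘_)) (b ∷ zs)
  ∏⊘-partialFractions b []       _              _                 = sym (+-identityʳ _)
  ∏⊘-partialFractions {y} b (z ∷ zs) (y≉b ∷ y≉zs) (b≉zs ∷ unique) = begin
    y ⊘ b * ∏ (z ∷ zs) (y ⊘_)
      ≈⟨ *-congˡ (∏⊘-partialFractions z zs y≉zs unique) ⟩
    y ⊘ b * ∑pick (λ x rest → y ⊘ x * P x rest) (z ∷ zs)
      ≈⟨ ∑pick-* (y ⊘ b) (λ x rest → y ⊘ x * P x rest) (z ∷ zs) ⟨
    ∑pick (λ x rest → y ⊘ b * (y ⊘ x * P x rest)) (z ∷ zs)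
      ≈⟨ ∑pick-cong (z ∷ zs) (All.zipWith (λ (y≉x , b≉x) → split y≉x b≉x) (y≉zs , b≉zs)) ⟩
    ∑pick (λ x rest → y ⊘ x * P x (b ∷ rest) + y ⊘ b * (b ⊘ x * P x rest)) (z ∷ zs)
      ≈⟨ ∑pick-+ (λ x rest → y ⊘ x * P x (b ∷ rest)) (λ x rest → y ⊘ b * (b ⊘ x * P x rest)) (z ∷ zs) ⟩
    ∑pick (λ x rest → y ⊘ x * P x (b ∷ rest)) (z ∷ zs) + ∑pick (λ x rest → y ⊘ b * (b ⊘ x * P x rest)) (z ∷ zs)
      ≈⟨ +-congˡ (∑pick-* (y ⊘ b) (λ x rest → b ⊘ x * P x rest) (z ∷ zs)) ⟩
    ∑pick (λ x rest → y ⊘ x * P x (b ∷ rest)) (z ∷ zs) + y ⊘ b * ∑pick (λ x rest → b ⊘ x * P x rest) (z ∷ zs)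
      ≈⟨ +-congˡ (*-congˡ (∏⊘-partialFractions z zs b≉zs unique)) ⟨
    ∑pick (λ x rest → y ⊘ x * P x (b ∷ rest)) (z ∷ zs) + y ⊘ b * P b (z ∷ zs)
      ≈⟨ +-comm _ _ ⟩
    y ⊘ b * P b (z ∷ zs) + ∑pick (λ x rest → y ⊘ x * P x (b ∷ rest)) (z ∷ zs) ∎
    where
    P : Carrier → List Carrier → Carrier
    P x rest = ∏ rest (x ⊘_)
    split : ∀ {x} → y ≉ x → b ≉ x → ∀ rest →
            y ⊘ b * (y ⊘ x * P x rest) ≈ y ⊘ x * P x (b ∷ rest) + y ⊘ b * (b ⊘ x * P x rest)
    split {x} y≉x b≉x rest = begin
      y ⊘ b * (y ⊘ x * P x rest)                          ≈⟨ *-assoc _ _ _ ⟨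
      y ⊘ b * y ⊘ x * P x rest                            ≈⟨ *-congʳ (⊘-partialFraction y≉x y≉b (b≉x ∘ sym)) ⟩
      (y ⊘ x * x ⊘ b + y ⊘ b * b ⊘ x) * P x rest          ≈⟨ distribʳ _ _ _ ⟩
      y ⊘ x * x ⊘ b * P x rest + y ⊘ b * b ⊘ x * P x rest ≈⟨ +-cong (*-assoc _ _ _) (*-assoc _ _ _) ⟩
      y ⊘ x * P x (b ∷ rest) + y ⊘ b * (b ⊘ x * P x rest) ∎

  ∑pick-lagrange : ∀ x xs → Unique (x ∷ xs) → ∑pick (λ y rest → ∏ rest (y ⊘_)) (x ∷ xs) ≈ 1#
  ∑pick-lagrange x []       _                = +-identityʳ 1#
  ∑pick-lagrange x (w ∷ ws) (x≉xs ∷ unique) = begin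
    ∏ (w ∷ ws) (x ⊘_) + ∑pick (λ y rest → y ⊘ x * P y rest) (w ∷ ws)
      ≈⟨ +-congʳ (∏⊘-partialFractions w ws x≉xs unique) ⟩
    ∑pick (λ y rest → x ⊘ y * P y rest) (w ∷ ws) + ∑pick (λ y rest → y ⊘ x * P y rest) (w ∷ ws)
      ≈⟨ ∑pick-+ (λ y rest → x ⊘ y * P y rest) (λ y rest → y ⊘ x * P y rest) (w ∷ ws) ⟨
    ∑pick (λ y rest → x ⊘ y * P y rest + y ⊘ x * P y rest) (w ∷ ws)
      ≈⟨ ∑pick-cong (w ∷ ws) (All.map complement x≉xs) ⟩
    ∑pick P (w ∷ ws)
      ≈⟨ ∑pick-lagrange w ws unique ⟩
    1# ∎
    where
    P : Carrier → List Carrier → Carrier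
    P y rest = ∏ rest (y ⊘_)
    complement : ∀ {y} → x ≉ y → ∀ rest → x ⊘ y * P y rest + y ⊘ x * P y rest ≈ P y rest
    complement x≉y rest = trans (sym (distribʳ _ _ _)) (trans (*-congʳ (⊘-complement x≉y)) (*-identityˡ _))

  lagrangeTerm : List Carrier → Carrier
  lagrangeTerm []       = 1#
  lagrangeTerm (x ∷ xs) = ∏ xs (x ⊘_)

  ∑-rotations≈∑pick : ∀ post pre →
    ∑ (iterate rotate (post ++ pre) (length post)) lagrangeTerm ≈ ∑pick (λ x rest → ∏ (rest ++ pre) (x ⊘_)) post
  ∑-rotations≈∑pick []         pre = refl
  ∑-rotations≈∑pick (z ∷ post) pre = +-congˡ (begin
    ∑ (iterate rotate ((post ++ pre) ∷ʳ z) (length post)) lagrangeTerm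
      ≡⟨ cong (λ xs → ∑ (iterate rotate xs (length post)) lagrangeTerm) (List.++-assoc post pre (z ∷ [])) ⟩
    ∑ (iterate rotate (post ++ pre ∷ʳ z) (length post)) lagrangeTerm
      ≈⟨ ∑-rotations≈∑pick post (pre ∷ʳ z) ⟩
    ∑pick (λ x rest → ∏ (rest ++ pre ∷ʳ z) (x ⊘_)) post
      ≈⟨ ∑pick-cong post (All.universal (λ x rest → ∏-∷ʳ-++ x rest) post) ⟩
    ∑pick (λ x rest → ∏ (z ∷ rest ++ pre) (x ⊘_)) post ∎)
    where
    ∏-∷ʳ-++ : ∀ x rest → ∏ (rest ++ pre ∷ʳ z) (x ⊘_) ≈ ∏ (z ∷ rest ++ pre) (x ⊘_)
    ∏-∷ʳ-++ x rest = trans (reflexive (cong (λ xs → ∏ xs (x ⊘_)) (≡.sym (List.++-assoc rest pre (z ∷ [])))))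
                           (∏-∷ʳ (rest ++ pre) z (x ⊘_))

  lagrange : ∀ x xs → Unique (x ∷ xs) → ∑ (iterate rotate (x ∷ xs) (suc (length xs))) lagrangeTerm ≈ 1#
  lagrange x xs unique = begin
    ∑ (iterate rotate (x ∷ xs) (suc (length xs))) lagrangeTerm
      ≡⟨ cong (λ ys → ∑ (iterate rotate ys (suc (length xs))) lagrangeTerm) (List.++-identityʳ (x ∷ xs)) ⟨
    ∑ (iterate rotate ((x ∷ xs) ++ []) (suc (length xs))) lagrangeTerm
      ≈⟨ ∑-rotations≈∑pick (x ∷ xs) [] ⟩
    ∑pick (λ y rest → ∏ (rest ++ []) (y ⊘_)) (x ∷ xs)
      ≈⟨ ∑pick-cong (x ∷ xs) (All.universal (λ y rest → reflexive (cong (λ r → ∏ r (y ⊘_)) (List.++-identityʳ rest)))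
                                           (x ∷ xs)) ⟩
    ∑pick (λ y rest → ∏ rest (y ⊘_)) (x ∷ xs)
      ≈⟨ ∑pick-lagrange x xs unique ⟩
    1# ∎

  record _∝_ (xs ys : List Carrier) : Set (c ⊔ ℓ) where
    field
      factor   : Carrier
      factor≉0 : factor ≉ 0#
      scaled   : map (factor *_) xs ≋ ys

  ∝-refl : ∀ xs → xs ∝ xs
  ∝-refl xs = record { factor = 1# ; factor≉0 = 0≉1 ∘ sym ; scaled = unit xs }
    where
    unit : ∀ xs → map (1# *_) xs ≋ xs
    unit []       = []
    unit (x ∷ xs) = *-identityˡ x ∷ unit xs

  ∝-trans : ∀ {xs ys zs} → xs ∝ ys → ys ∝ zs → xs ∝ zs
  ∝-trans {xs} {ys} {zs} record { factor = μ ; factor≉0 = μ≉0 ; scaled = μxs≋ys }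
                         record { factor = ν ; factor≉0 = ν≉0 ; scaled = νys≋zs } = record
    { factor   = ν * μ
    ; factor≉0 = *-≉0 ν≉0 μ≉0
    ; scaled   = go xs μxs≋ys νys≋zs
    }
    where
    go : ∀ xs {ys zs} → map (μ *_) xs ≋ ys → map (ν *_) ys ≋ zs → map ((ν * μ) *_) xs ≋ zs
    go []       []             []             = []
    go (x ∷ xs) (μx≈y ∷ μxs≋ys) (νy≈z ∷ νys≋zs) =
      trans (*-assoc ν μ x) (trans (*-congˡ μx≈y) νy≈z) ∷ go xs μxs≋ys νys≋zs

  rotate⁺ : ∀ {xs ys} → xs ≋ ys → rotate xs ≋ rotate ys
  rotate⁺ []              = []
  rotate⁺ (x≈y ∷ xs≋ys) = Pointwise.++⁺ xs≋ys (x≈y ∷ [])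

  rotate-∝ : ∀ {xs ys} → xs ∝ ys → rotate xs ∝ rotate ys
  rotate-∝ {xs} record { factor = μ ; factor≉0 = μ≉0 ; scaled = μxs≋ys } = record
    { factor   = μ
    ; factor≉0 = μ≉0
    ; scaled   = ≡.subst (_≋ _) (rotate-map (μ *_) xs) (rotate⁺ μxs≋ys)
    }

  lagrangeTerm-∝ : ∀ {xs ys} → xs ∝ ys → Unique ys → lagrangeTerm xs ≈ lagrangeTerm ys
  lagrangeTerm-∝ {[]}     record { scaled = [] } _ = refl
  lagrangeTerm-∝ {x ∷ xs} {y ∷ ys} record { factor = μ ; factor≉0 = μ≉0 ; scaled = μx≈y ∷ μxs≋ys } (y≉ys ∷ _) =
    go xs μxs≋ys y≉ys
    where
    go : ∀ xs {ys} → map (μ *_) xs ≋ ys → All (y ≉_) ys → ∏ xs (x ⊘_) ≈ ∏ ys (y ⊘_)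
    go []       []              []           = refl
    go (z ∷ zs) (μz≈w ∷ μzs≋ws) (y≉w ∷ y≉ws) = *-cong (⊘-scale μ≉0 μx≈y μz≈w y≉w) (go zs μzs≋ws y≉ws)

  module Points (ζ : Carrier) where

    points : List ℕ → List Carrier
    points ds = map (ζ ^_) (partialSums 0 ds)

    points-rotate : ∀ ds → ζ ^ sum ds ≈ 1# → points (rotate ds) ∝ rotate (points ds)
    points-rotate []       _      = ∝-refl []
    points-rotate (d ∷ ds) ζ^Σ≈1 = record
      { factor   = ζ ^ d
      ; factor≉0 = x*y≈1⇒x≉0 (trans (sym (^-homo-* ζ d (sum ds))) ζ^Σ≈1)
      ; scaled   = ≋-trans (shift ts) (≋-trans (≋-reflexive exponents) (Pointwise.++⁺ ≋-refl (ζ^Σ≈1 ∷ [])))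
      }
      where
      ts = partialSums 0 (rotate (d ∷ ds))
      exponents : map (ζ ^_) (map (d ℕ.+_) ts) ≡ map (ζ ^_) (partialSums d ds) ∷ʳ ζ ^ sum (d ∷ ds)
      exponents = ≡.trans (cong (map (ζ ^_)) (partialSums-rotate d ds)) (List.map-++ (ζ ^_) (partialSums d ds) _)
      shift : ∀ ts → map (ζ ^ d *_) (map (ζ ^_) ts) ≋ map (ζ ^_) (map (d ℕ.+_) ts)
      shift []       = []
      shift (t ∷ ts) = sym (^-homo-* ζ d t) ∷ shift ts

    ∑-rotations-∝ : ∀ k ds {ys} → ζ ^ sum ds ≈ 1# → points ds ∝ ys → Unique ys →
                    ∑ (iterate rotate ds k) (lagrangeTerm ∘ points) ≈ ∑ (iterate rotate ys k) lagrangeTerm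
    ∑-rotations-∝ zero    ds ζ^Σ≈1 ds∝ys unique = refl
    ∑-rotations-∝ (suc k) ds ζ^Σ≈1 ds∝ys unique = +-cong (lagrangeTerm-∝ ds∝ys unique)
      (∑-rotations-∝ k (rotate ds) (trans (reflexive (cong (ζ ^_) (sum-rotate ds))) ζ^Σ≈1)
        (∝-trans (points-rotate ds ζ^Σ≈1) (rotate-∝ ds∝ys)) (AllPairs-rotate⁺ (_∘ sym) unique))

    ∑-rotations-points : ∀ d ds → ζ ^ sum (d ∷ ds) ≈ 1# → Unique (points (d ∷ ds)) →
                         ∑ (iterate rotate (d ∷ ds) (suc (length ds))) (lagrangeTerm ∘ points) ≈ 1#
    ∑-rotations-points d ds ζ^Σ≈1 unique = begin
      ∑ (iterate rotate (d ∷ ds) (suc (length ds))) (lagrangeTerm ∘ points)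
        ≈⟨ ∑-rotations-∝ (suc (length ds)) (d ∷ ds) ζ^Σ≈1 (∝-refl (points (d ∷ ds))) unique ⟩
      ∑ (iterate rotate (points (d ∷ ds)) (suc (length ds))) lagrangeTerm
        ≡⟨ cong (λ k → ∑ (iterate rotate (points (d ∷ ds)) (suc k)) lagrangeTerm) length≡ ⟨
      ∑ (iterate rotate (1# ∷ xs) (suc (length xs))) lagrangeTerm
        ≈⟨ lagrange 1# xs unique ⟩
      1# ∎
      where
      xs = map (ζ ^_) (partialSums d ds)
      length≡ : length xs ≡ length ds
      length≡ = ≡.trans (List.length-map (ζ ^_) (partialSums d ds)) (length-partialSums d ds)

module PrimitiveRootOfUnity {c ℓ} (F : Field c ℓ) {N ζ} (ζ-primitive : PrimitiveRoot F N ζ) where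

  open Field F
  open FieldTheory F
  open Points ζ
  open import Algebra.Properties.Semiring.Exp semiring using (^-homo-*)
  open import Data.List.Relation.Unary.Unique.Setoid setoid using (Unique)
  open import Relation.Binary.Reasoning.Setoid setoid

  ζ^≉0 : ∀ {a} → a ≤ N → ζ ^ a ≉ 0#
  ζ^≉0 {a} a≤N = x*y≈1⇒x≉0 (begin
    ζ ^ a * ζ ^ (N ∸ a) ≈⟨ ^-homo-* ζ a (N ∸ a) ⟨
    ζ ^ (a ℕ.+ (N ∸ a)) ≡⟨ cong (ζ ^_) (ℕₚ.m+[n∸m]≡n a≤N) ⟩
    ζ ^ N               ≈⟨ proj₁ ζ-primitive ⟩
    1#                  ∎)

  ζ^-injective : ∀ {a b} → a < b → b < N → ζ ^ a ≉ ζ ^ b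
  ζ^-injective {a} {b} a<b b<N ζ^a≈ζ^b =
    proj₂ ζ-primitive (b ∸ a) (ℕₚ.m<n⇒0<n∸m a<b) (ℕₚ.≤-<-trans (ℕₚ.m∸n≤m b a) b<N) ζ^[b∸a]≈1
    where
    a≤N : a ≤ N
    a≤N = ℕₚ.<⇒≤ (ℕₚ.<-trans a<b b<N)
    ζ^[b∸a]≈1 : ζ ^ (b ∸ a) ≈ 1#
    ζ^[b∸a]≈1 = *-cancelʳ (ζ^≉0 a≤N) (begin
      ζ ^ (b ∸ a) * ζ ^ a ≈⟨ ^-homo-* ζ (b ∸ a) a ⟨
      ζ ^ (b ∸ a ℕ.+ a)   ≡⟨ cong (ζ ^_) (ℕₚ.m∸n+n≡m (ℕₚ.<⇒≤ a<b)) ⟩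
      ζ ^ b               ≈⟨ ζ^a≈ζ^b ⟨
      ζ ^ a               ≈⟨ *-identityˡ (ζ ^ a) ⟨
      1# * ζ ^ a          ∎)

  points-unique : ∀ {ds} → All (0 <_) ds → sum ds ≡ N → Unique (points ds)
  points-unique ds>0 Σds≡N = go (partialSums-increasing 0 ds>0)
    (≡.subst (λ t → All (_< t) _) Σds≡N (partialSums-upperBound 0 ds>0))
    where
    go : ∀ {ts} → AllPairs _<_ ts → All (_< N) ts → Unique (map (ζ ^_) ts)
    go []            []           = []
    go (t<ts ∷ <ts) (_ ∷ ts<N) =
      All.map⁺ (All.zipWith (λ (t<u , u<N) → ζ^-injective t<u u<N) (t<ts , ts<N)) ∷ go <ts ts<N

module _ {c ℓ} (F : Field c ℓ) (m n : ℕ) {ζ} (ζ-primitive : PrimitiveRoot F (suc m ℕ.* n) ζ) where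

  open Field F
  open FieldTheory F
  open Points ζ
  open PrimitiveRootOfUnity F ζ-primitive
  open BigOperators +-commutativeMonoid
  open BigOperators *-commutativeMonoid using () renaming (∑ to ∏; ∑-map to ∏-map)
  open import Algebra.Properties.Monoid.Mult +-monoid using (×-congʳ)
  open import Relation.Binary.Reasoning.Setoid setoid

  weight : List ℕ → Carrier
  weight bs = termFrom F ζ m 1 (drop 1 (partialSums 0 bs))

  termFrom-partialSums : ∀ {e j i} bs → e ℕ.+ j ≡ suc m ℕ.* i → All (0 <_) bs →
    termFrom F ζ m j (partialSums i bs) ≈ ∏ (partialSums e (map (gap m) bs)) (λ t → 1# ⊘ (ζ ^ t))
  termFrom-partialSums               []       _     _            = refl
  termFrom-partialSums {e} {j} {i} (b ∷ bs) e+j≡ (b>0 ∷ bs>0) =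
    *-cong factor (termFrom-partialSums bs (gap-step m e+j≡ b>0) bs>0)
    where
    exponent : suc m ℕ.* i ∸ j ≡ e
    exponent = ≡.trans (cong (_∸ j) (≡.sym e+j≡)) (ℕₚ.m+n∸n≡m e j)
    factor : (1# - ζ ^ (suc m ℕ.* i ∸ j)) ⁻¹ ≈ 1# ⊘ (ζ ^ e)
    factor = trans (reflexive (cong (λ t → (1# - ζ ^ t) ⁻¹) exponent)) (sym (*-identityˡ _))

  weight≈lagrangeTerm : ∀ {bs} → All (0 <_) bs → weight bs ≈ lagrangeTerm (points (map (gap m) bs))
  weight≈lagrangeTerm {[]}     []           = refl
  weight≈lagrangeTerm {b ∷ bs} (b>0 ∷ bs>0) = trans (termFrom-partialSums bs (gap+1≡ m b>0) bs>0)
    (reflexive (≡.sym (∏-map (ζ ^_) (partialSums (gap m b) (map (gap m) bs)) (1# ⊘_))))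

  ∑-rotations-weight : 0 < m → ∀ {bs} → IsComposition (suc m) (suc n) bs →
                       ∑ (iterate rotate bs (suc m)) weight ≈ 1#
  ∑-rotations-weight m>0 {b ∷ bs} c = begin
    ∑ (iterate rotate (b ∷ bs) (suc m)) weight
      ≈⟨ ∑-cong (All.map weight≈lagrangeTerm (All-iterate⁺ {P = All (0 <_)} All-rotate⁺ (suc m) parts>0)) ⟩
    ∑ (iterate rotate (b ∷ bs) (suc m)) (lagrangeTerm ∘ points ∘ map (gap m))
      ≡⟨ ∑-map (map (gap m)) (iterate rotate (b ∷ bs) (suc m)) (lagrangeTerm ∘ points) ⟨
    ∑ (map (map (gap m)) (iterate rotate (b ∷ bs) (suc m))) (lagrangeTerm ∘ points)
      ≡⟨ cong (λ dss → ∑ dss (lagrangeTerm ∘ points)) (iterate-rotate-map (gap m) (b ∷ bs) (suc m)) ⟨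
    ∑ (iterate rotate (map (gap m) (b ∷ bs)) (suc m)) (lagrangeTerm ∘ points)
      ≡⟨ cong (λ k → ∑ (iterate rotate (map (gap m) (b ∷ bs)) (suc k)) (lagrangeTerm ∘ points)) length-gaps ⟨
    ∑ (iterate rotate (gap m b ∷ map (gap m) bs) (suc (length (map (gap m) bs)))) (lagrangeTerm ∘ points)
      ≈⟨ ∑-rotations-points (gap m b) (map (gap m) bs) ζ^Σgaps≈1 (points-unique gaps>0 Σgaps≡N) ⟩
    1# ∎
    where
    open IsComposition c
    gaps>0 : All (0 <_) (map (gap m) (b ∷ bs))
    gaps>0 = All.map⁺ (All.map (gap>0 m>0) parts>0)
    Σgaps≡N : sum (map (gap m) (b ∷ bs)) ≡ suc m ℕ.* n
    Σgaps≡N = sum-map-gap-composition m n c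
    ζ^Σgaps≈1 : ζ ^ sum (map (gap m) (b ∷ bs)) ≈ 1#
    ζ^Σgaps≈1 = trans (reflexive (cong (ζ ^_) Σgaps≡N)) (proj₁ ζ-primitive)
    length-gaps : length (map (gap m) bs) ≡ m
    length-gaps = ≡.trans (List.length-map (gap m) bs) (ℕₚ.suc-injective length≡)

  𝒯≈∑comp-weight : 𝒯 F n ζ m ≈ ∑comp (suc m) (suc n) weight
  𝒯≈∑comp-weight = begin
    ∑ (choose (oneTo n) m) (termFrom F ζ m 1)
      ≡⟨ cong (λ xs → ∑ (choose xs m) (termFrom F ζ m 1)) (oneTo≡iterate n) ⟩
    ∑ (choose (iterate suc 1 n) m) (termFrom F ζ m 1)
      ≈⟨ ∑-choose 0 n m (termFrom F ζ m 1) ⟩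
    ∑comp (suc m) (suc n) weight ∎

  [m+1]×𝒯≈[nCm]×1 : 0 < m → suc m × 𝒯 F n ζ m ≈ (n C m) × 1#
  [m+1]×𝒯≈[nCm]×1 m>0 = begin
    suc m × 𝒯 F n ζ m
      ≈⟨ ×-congʳ (suc m) 𝒯≈∑comp-weight ⟩
    suc m × ∑comp (suc m) (suc n) weight
      ≈⟨ ∑comp-∑-rotations (suc m) m (suc n) weight ⟨
    ∑comp (suc m) (suc n) (λ bs → ∑ (iterate rotate bs (suc m)) weight)
      ≈⟨ ∑comp-cong (suc m) (suc n) (λ _ → ∑-rotations-weight m>0) ⟩
    ∑comp (suc m) (suc n) (λ _ → 1#)
      ≈⟨ ∑comp-const m n 1# ⟩
    (n C m) × 1# ∎

open import Data.Nat using (_*_)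

theorem2 : ∀ {c ℓ} (F : Field c ℓ) → CharZero F →
    (n m : ℕ) → n ≥ 1 → m ≥ 1 →
    (ζ : Field.Carrier F) → PrimitiveRoot F (suc m * n) ζ →
    Field._≈_ F (𝒯 F n ζ m)
      (Field._*_ F (Field._⁻¹ F (Field._×_ F (suc m) (Field.1# F)))
                   (Field._×_ F (n C m) (Field.1# F)))
theorem2 F charZero n m _ m≥1 ζ ζ-primitive = x*y≈z⇒y≈x⁻¹*z (charZero m) (begin
  suc m × 1# · 𝒯 F n ζ m   ≈⟨ ×-assoc-* (suc m) 1# (𝒯 F n ζ m) ⟩
  suc m × (1# · 𝒯 F n ζ m) ≈⟨ ×-congʳ (suc m) (*-identityˡ (𝒯 F n ζ m)) ⟩
  suc m × 𝒯 F n ζ m        ≈⟨ [m+1]×𝒯≈[nCm]×1 F m n ζ-primitive m≥1 ⟩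
  (n C m) × 1#             ∎)
  where
  open Field F renaming (_*_ to _·_)
  open FieldTheory F using (x*y≈z⇒y≈x⁻¹*z)
  open import Algebra.Properties.Semiring.Mult semiring using (×-assoc-*; ×-congʳ)
  open import Relation.Binary.Reasoning.Setoid setoid
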